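{- For every integer $n\geq 1$, let $C_{\mathrm{NFW}}(n)$ be the maximum of $C_{\mathrm{NFW}}(\mathcal{A})$ over all NFWs $\mathcal{A}$ with $n$ states. Then $C_{\mathrm{NFW}}(n)=C_{\mathrm{NFW}}(\mathcal{A})$ for some full NFW $\mathcal{A}$ with $n$ states.
   Context: An NFW (nondeterministic finite word automaton) is $\mathcal{A}=(\Sigma,S,I,\Delta,F)$ with finite alphabet $\Sigma$, finite state set $S$, initial states $I\subseteq S$, transition relation $\Delta\subseteq S\times\Sigma\times S$ and final states $F\subseteq S$. A finite word $a(0)\cdots a(l-1)$ is accepted if there is a state sequence $\rho(0)\cdots\rho(l)$ with $\rho(0)\in I$, $\rho(l)\in F$ and $\langle\rho(i),a(i),\rho(i+1)\rangle\in\Delta$ for all $i<l$. $\mathcal{L}(\mathcal{A})$ is the set of accepted words. $C_{\mathrm{NFW}}(\mathcal{A})$ is the minimum number of states of an NFW (over the same alphabet) accepting $\Sigma^*\setminus\mathcal{L}(\mathcal{A})$. A full NFW is one of the form $(\Sigma,S,I,\Delta,F)$ where $S$ is a finite set, $I,F\subseteq S$ are arbitrary, $\Sigma=\mathcal{P}(S\times S)$ is the set of all binary relations on $S$, and $\langle p,a,q\rangle\in\Delta$ iff $\langle p,q\rangle\in a$. -}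

module Defs where

open import Data.Nat using (ℕ; _≤_)
open import Data.Fin using (Fin)
open import Data.Bool using (Bool; T)
open import Data.List using (List; []; _∷_)
open import Data.Product using (Σ; Σ-syntax; _×_; ∃)
open import Relation.Nullary using (¬_)
open import Function.Bundles using (_↔_)

record NFW (Σ' : Set) (n : ℕ) : Set where
  field
    init  : Fin n → Bool
    trans : Fin n → Σ' → Fin n → Bool
    final : Fin n → Bool
open NFW public

AcceptsFrom : {Σ' : Set} {n : ℕ} → NFW Σ' n → Fin n → List Σ' → Set
AcceptsFrom A p []      = T (final A p)
AcceptsFrom A p (a ∷ w) = Σ[ q ∈ Fin _ ] (T (trans A p a q) × AcceptsFrom A q w)

Accepts : {Σ' : Set} {n : ℕ} → NFW Σ' n → List Σ' → Set
Accepts A w = Σ[ p ∈ Fin _ ] (T (init A p) × AcceptsFrom A p w)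

Complements : {Σ' : Set} {m n : ℕ} → NFW Σ' m → NFW Σ' n → Set
Complements B A = ∀ w → (Accepts B w → ¬ Accepts A w) × (¬ Accepts A w → Accepts B w)

IsComplementComplexity : {Σ' : Set} {n : ℕ} → NFW Σ' n → ℕ → Set
IsComplementComplexity {Σ'} A c =
  (Σ[ B ∈ NFW Σ' c ] Complements B A) ×
  (∀ (m : ℕ) (B : NFW Σ' m) → Complements B A → c ≤ m)

FiniteAlphabet : Set → Set
FiniteAlphabet Σ' = ∃ λ k → Σ' ↔ Fin k

Rel : ℕ → Set
Rel n = Fin n → Fin n → Bool

fullNFW : (n : ℕ) → (Fin n → Bool) → (Fin n → Bool) → NFW (Rel n) n
fullNFW n I F = record { init = I ; trans = λ p a q → a p q ; final = F }

module Submission where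

-- Both bounds meet at 2 ^ n:
--  * Upper bound (every NFW).  For any n-state NFW A, determinising by the
--    subset construction and swapping accepting and rejecting subsets gives
--    a 2 ^ n-state NFW for the complement, so C_NFW(A) ≤ 2 ^ n.  Take the full NFW with I = F = {0}.  For a
--    subset X let enter X = {(0,q) | q ∈ X} and leave X = {(p,0) | p ∉ X}.
--    The word (enter X)(leave Y) is accepted iff X ⊈ Y, so the 2 ^ n pairs
--    ([enter X], [leave X]) form an extended fooling set for the complement,
--    and the fooling-set lemma (a pigeonhole argument on the midpoints of
--    accepting runs) forces every complementing NFW to have ≥ 2 ^ n states.
-- Hence that full NFW has complement complexity exactly 2 ^ n, which bounds
-- the complement complexity of every n-state NFW.

open import Defs
open import Data.Nat using (ℕ; zero; suc; _≤_; _^_)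
open import Data.Nat.Properties using (_≤?_; ≰⇒>)
open import Data.Fin using (Fin; zero; suc; _<_; _≟_; combine; finToFun; funToFin)
open import Data.Fin.Properties
  using (2↔Bool; finToFun-funToFin; funToFin-finToFin; any?; ¬∀⟶∃¬; pigeonhole; <⇒≢)
open import Data.Bool using (Bool; true; false; T; not; _∧_)
open import Data.Bool.Properties using (T?; T-∧) renaming (_≟_ to _≟ᵇ_)
open import Data.List using (List; []; _∷_; _++_)
open import Data.Product using (Σ-syntax; _×_; _,_; proj₁; proj₂)
open import Data.Sum using (_⊎_; inj₁; inj₂; [_,_]′) renaming (map to ⊎-map)
open import Data.Unit using (tt)
open import Function using (_∘_)
open import Function.Bundles using (_⇔_; mk⇔; Equivalence; Inverse)
open import Relation.Nullary using (¬_; yes; no; contradiction)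
open import Relation.Nullary.Decidable using (⌊_⌋; toWitness; fromWitness)
open import Relation.Binary.PropositionalEquality
  using (_≡_; refl; sym; cong; cong₂; subst; _≗_; module ≡-Reasoning)

open Equivalence using (to; from)

T-not : ∀ {b} → T (not b) ⇔ (¬ T b)
T-not {true}  = mk⇔ (λ ()) (λ f → f tt)
T-not {false} = mk⇔ (λ _ ()) (λ _ → tt)

anyᵇ : ∀ {n} → (Fin n → Bool) → Bool
anyᵇ f = ⌊ any? (T? ∘ f) ⌋

T-anyᵇ : ∀ {n} (f : Fin n → Bool) → T (anyᵇ f) ⇔ (Σ[ p ∈ Fin n ] T (f p))
T-anyᵇ f = mk⇔ toWitness fromWitness

funToFin-cong : ∀ {m k} {f g : Fin m → Fin k} → f ≗ g → funToFin f ≡ funToFin g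
funToFin-cong {zero}  f≗g = refl
funToFin-cong {suc m} f≗g = cong₂ combine (f≗g zero) (funToFin-cong (f≗g ∘ suc))

Subset : ℕ → Set
Subset n = Fin n → Bool

module _ {n : ℕ} where
  open Inverse 2↔Bool using (strictlyInverseˡ; strictlyInverseʳ)
    renaming (to to bool; from to bit)

  decode : Fin (2 ^ n) → Subset n
  decode i q = bool (finToFun i q)

  code : Subset n → Fin (2 ^ n)
  code X = funToFin (bit ∘ X)

  decode-code : ∀ X → decode (code X) ≗ X
  decode-code X q = begin
    bool (finToFun (code X) q)  ≡⟨ cong bool (finToFun-funToFin (bit ∘ X) q) ⟩
    bool (bit (X q))            ≡⟨ strictlyInverseˡ (X q) ⟩
    X q                         ∎
    where open ≡-Reasoning

  decode-injective : ∀ i j → decode i ≗ decode j → i ≡ j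
  decode-injective i j same = begin
    i                              ≡⟨ sym (funToFin-finToFin {n} {2} i) ⟩
    funToFin (finToFun {2} {n} i)  ≡⟨ funToFin-cong sameBits ⟩
    funToFin (finToFun {2} {n} j)  ≡⟨ funToFin-finToFin {n} {2} j ⟩
    j                              ∎
    where
    open ≡-Reasoning
    sameBits : finToFun {2} {n} i ≗ finToFun j
    sameBits q = begin
      finToFun i q              ≡⟨ sym (strictlyInverseʳ (finToFun i q)) ⟩
      bit (decode i q)          ≡⟨ cong bit (same q) ⟩
      bit (decode j q)          ≡⟨ strictlyInverseʳ (finToFun j q) ⟩
      finToFun j q              ∎

module SubsetConstruction {Σ' : Set} {n : ℕ} (A : NFW Σ' n) where

  AcceptsFromSet : Subset n → List Σ' → Set
  AcceptsFromSet X w = Σ[ p ∈ Fin n ] (T (X p) × AcceptsFrom A p w)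

  AcceptsFromSet-cong : ∀ {X Y} → X ≗ Y → ∀ w → AcceptsFromSet X w → AcceptsFromSet Y w
  AcceptsFromSet-cong X≗Y w (p , p∈X , run) = p , subst T (X≗Y p) p∈X , run

  post : Subset n → Σ' → Subset n
  post X a q = anyᵇ (λ p → X p ∧ trans A p a q)

  hasFinal : Subset n → Bool
  hasFinal X = anyᵇ (λ p → X p ∧ final A p)

  hasFinal-spec : ∀ X → T (hasFinal X) ⇔ AcceptsFromSet X []
  hasFinal-spec X = mk⇔ forward backward
    where
    forward : T (hasFinal X) → AcceptsFromSet X []
    forward t with p , p∈X∧pF ← to (T-anyᵇ _) t = p , to T-∧ p∈X∧pF
    backward : AcceptsFromSet X [] → T (hasFinal X)
    backward (p , p∈X , pF) = from (T-anyᵇ _) (p , from T-∧ (p∈X , pF))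

  post-spec : ∀ X a w → AcceptsFromSet X (a ∷ w) ⇔ AcceptsFromSet (post X a) w
  post-spec X a w = mk⇔ forward backward
    where
    forward : AcceptsFromSet X (a ∷ w) → AcceptsFromSet (post X a) w
    forward (p , p∈X , q , p→q , run) = q , from (T-anyᵇ _) (p , from T-∧ (p∈X , p→q)) , run
    backward : AcceptsFromSet (post X a) w → AcceptsFromSet X (a ∷ w)
    backward (q , q∈post , run) with p , p∈X∧p→q ← to (T-anyᵇ _) q∈post =
      p , proj₁ (to T-∧ p∈X∧p→q) , q , proj₂ (to T-∧ p∈X∧p→q) , run

  complementNFW : NFW Σ' (2 ^ n)
  complementNFW = record
    { init  = λ i → ⌊ i ≟ code (init A) ⌋
    ; trans = λ i a j → ⌊ j ≟ code (post (decode i) a) ⌋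
    ; final = λ i → not (hasFinal (decode i))
    }

  complement-run : ∀ i w → AcceptsFrom complementNFW i w ⇔ (¬ AcceptsFromSet (decode i) w)
  complement-run i [] = mk⇔
    (λ t → to T-not t ∘ from (hasFinal-spec (decode i)))
    (λ ¬acc → from T-not (¬acc ∘ to (hasFinal-spec (decode i))))
  complement-run i (a ∷ w) = mk⇔ forward backward
    where
    S = post (decode i) a
    forward : AcceptsFrom complementNFW i (a ∷ w) → ¬ AcceptsFromSet (decode i) (a ∷ w)
    forward (j , j≡S , run) with refl ← toWitness j≡S =
      to (complement-run (code S) w) run
        ∘ AcceptsFromSet-cong (sym ∘ decode-code S) w ∘ to (post-spec (decode i) a w)
    backward : ¬ AcceptsFromSet (decode i) (a ∷ w) → AcceptsFrom complementNFW i (a ∷ w)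
    backward ¬acc = code S , fromWitness refl , from (complement-run (code S) w)
      (¬acc ∘ from (post-spec (decode i) a w) ∘ AcceptsFromSet-cong (decode-code S) w)

  complementNFW-complements : Complements complementNFW A
  complementNFW-complements w = forward , backward
    where
    I = init A
    forward : Accepts complementNFW w → ¬ Accepts A w
    forward (i , i≡I , run) with refl ← toWitness i≡I =
      to (complement-run (code I) w) run ∘ AcceptsFromSet-cong (sym ∘ decode-code I) w
    backward : ¬ Accepts A w → Accepts complementNFW w
    backward ¬acc = code I , fromWitness refl ,
      from (complement-run (code I) w) (¬acc ∘ AcceptsFromSet-cong (decode-code I) w)

open SubsetConstruction using (complementNFW; complementNFW-complements)

complexity-≤-2^n : ∀ {Σ' n c} (A : NFW Σ' n) → IsComplementComplexity A c → c ≤ 2 ^ n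
complexity-≤-2^n {n = n} A (_ , minimal) =
  minimal (2 ^ n) (complementNFW A) (complementNFW-complements A)

module FoolingSet {Σ' : Set} {m : ℕ} (B : NFW Σ' m) where

  Path : Fin m → List Σ' → Fin m → Set
  Path p []      q = p ≡ q
  Path p (a ∷ u) q = Σ[ r ∈ Fin m ] (T (trans B p a r) × Path r u q)

  Reaches : List Σ' → Fin m → Set
  Reaches u q = Σ[ p ∈ Fin m ] (T (init B p) × Path p u q)

  split : ∀ p u v → AcceptsFrom B p (u ++ v) → Σ[ q ∈ Fin m ] (Path p u q × AcceptsFrom B q v)
  split p []      v run                 = p , refl , run
  split p (a ∷ u) v (r , p→r , run) with q , r⇝q , rest ← split r u v run =
    q , (r , p→r , r⇝q) , rest

  glue : ∀ p u v q → Path p u q → AcceptsFrom B q v → AcceptsFrom B p (u ++ v)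
  glue p []      v .p refl              rest = rest
  glue p (a ∷ u) v q  (r , p→r , r⇝q)   rest = r , p→r , glue r u v q r⇝q rest

  midpoint : ∀ u v → Accepts B (u ++ v) → Σ[ q ∈ Fin m ] (Reaches u q × AcceptsFrom B q v)
  midpoint u v (p , p∈I , run) with q , p⇝q , rest ← split p u v run = q , (p , p∈I , p⇝q) , rest

  crossover : ∀ u v′ q → Reaches u q → AcceptsFrom B q v′ → Accepts B (u ++ v′)
  crossover u v′ q (p , p∈I , p⇝q) rest = p , p∈I , glue p u v′ q p⇝q rest

  -- If B accepts every u_i v_i, but for i < j rejects u_i v_j or u_j v_i,
  -- then B has at least k states: the midpoints of the k runs are distinct.
  fooling-set : ∀ {k} (u v : Fin k → List Σ') →
                (∀ i → Accepts B (u i ++ v i)) →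
                (∀ {i j} → i < j → ¬ Accepts B (u i ++ v j) ⊎ ¬ Accepts B (u j ++ v i)) →
                k ≤ m
  fooling-set {k} u v diagonal offDiagonal with k ≤? m
  ... | yes k≤m = k≤m
  ... | no  k≰m = contradiction (pigeonhole (≰⇒> k≰m) mid) noCollision
    where
    run : ∀ i → Σ[ q ∈ Fin m ] (Reaches (u i) q × AcceptsFrom B q (v i))
    run i = midpoint (u i) (v i) (diagonal i)
    mid : Fin k → Fin m
    mid i = proj₁ (run i)
    cross : ∀ i j → mid i ≡ mid j → Accepts B (u i ++ v j)
    cross i j mᵢ≡mⱼ = crossover (u i) (v j) (mid j)
      (subst (Reaches (u i)) mᵢ≡mⱼ (proj₁ (proj₂ (run i)))) (proj₂ (proj₂ (run j)))
    noCollision : ¬ (Σ[ i ∈ Fin k ] Σ[ j ∈ Fin k ] (i < j × mid i ≡ mid j))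
    noCollision (i , j , i<j , sameMid) =
      [ (λ ¬uᵢvⱼ → ¬uᵢvⱼ (cross i j sameMid)) , (λ ¬uⱼvᵢ → ¬uⱼvᵢ (cross j i (sym sameMid))) ]′
        (offDiagonal i<j)

NotSubset : ∀ {n} → Subset n → Subset n → Set
NotSubset {n} X Y = Σ[ q ∈ Fin n ] (T (X q) × ¬ T (Y q))

distinct-subsets : ∀ {n} (X Y : Subset n) → ¬ (X ≗ Y) → NotSubset X Y ⊎ NotSubset Y X
distinct-subsets {n} X Y X≢Y with q , Xq≢Yq ← ¬∀⟶∃¬ n (λ q → X q ≡ Y q) (λ q → X q ≟ᵇ Y q) X≢Y
  with X q in Xq | Y q in Yq
... | true  | false = inj₁ (q , subst T (sym Xq) tt , subst T Yq)
... | false | true  = inj₂ (q , subst T (sym Yq) tt , subst T Xq)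
... | true  | true  = contradiction refl Xq≢Yq
... | false | false = contradiction refl Xq≢Yq

isZero : ∀ {n} → Subset n
isZero zero    = true
isZero (suc _) = false

-- Lower bound, special part: the full NFW with I = F = {0} on n = suc k
-- states (the state 0 must exist).
module HardFullNFW (k : ℕ) where

  n : ℕ
  n = suc k

  A : NFW (Rel n) n
  A = fullNFW n isZero isZero

  enter leave : Subset n → Rel n
  enter X p q = isZero p ∧ X q
  leave Y p q = not (Y p) ∧ isZero q

  -- The only runs on (enter X)(leave Y) are 0 → q → 0 with q ∈ X, q ∉ Y.
  probe-accepted : ∀ X Y → NotSubset X Y → Accepts A (enter X ∷ leave Y ∷ [])
  probe-accepted X Y (q , q∈X , q∉Y) = zero , tt , q , q∈X , zero , from T-∧ (from T-not q∉Y , tt) , tt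

  probe-accepted⁻¹ : ∀ X Y → Accepts A (enter X ∷ leave Y ∷ []) → NotSubset X Y
  probe-accepted⁻¹ X Y (p , _ , q , p→q , r , q→r , _) =
    q , proj₂ (to (T-∧ {isZero p}) p→q) , to T-not (proj₁ (to T-∧ q→r))

  complement-lower-bound : ∀ m (B : NFW (Rel n) m) → Complements B A → 2 ^ n ≤ m
  complement-lower-bound m B complements =
    FoolingSet.fooling-set B (λ i → enter (decode i) ∷ []) (λ i → leave (decode i) ∷ [])
      diagonal offDiagonal
    where
    diagonal : ∀ i → Accepts B (enter (decode i) ∷ leave (decode i) ∷ [])
    diagonal i = proj₂ (complements (enter (decode i) ∷ leave (decode i) ∷ []))
      (λ acc → let q , q∈X , q∉X = probe-accepted⁻¹ (decode i) (decode i) acc in q∉X q∈X)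
    rejected : ∀ X Y → NotSubset X Y → ¬ Accepts B (enter X ∷ leave Y ∷ [])
    rejected X Y X⊈Y accB = proj₁ (complements (enter X ∷ leave Y ∷ [])) accB (probe-accepted X Y X⊈Y)
    offDiagonal : ∀ {i j} → i < j → ¬ Accepts B (enter (decode i) ∷ leave (decode j) ∷ [])
                                  ⊎ ¬ Accepts B (enter (decode j) ∷ leave (decode i) ∷ [])
    offDiagonal {i} {j} i<j =
      ⊎-map (rejected _ _) (rejected _ _)
        (distinct-subsets (decode i) (decode j) (<⇒≢ i<j ∘ decode-injective i j))

  full-complexity : IsComplementComplexity A (2 ^ n)
  full-complexity = (complementNFW A , complementNFW-complements A) , complement-lower-bound

theorem3p3 : (n : ℕ) → 1 ≤ n →
    Σ[ I ∈ (Fin n → Bool) ] Σ[ F ∈ (Fin n → Bool) ] Σ[ c ∈ ℕ ]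
      (IsComplementComplexity (fullNFW n I F) c ×
       (∀ (Σ' : Set) → FiniteAlphabet Σ' → (B : NFW Σ' n) → (c′ : ℕ) →
          IsComplementComplexity B c′ → c′ ≤ c))
theorem3p3 (suc k) _ =
  isZero , isZero , 2 ^ suc k , HardFullNFW.full-complexity k ,
  λ Σ' _ B c′ → complexity-≤-2^n B
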